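{- For every pair of integers $\ell\ge 3$ and $r\ge 3$ with $r$ odd, the generalised H-graph $H^\ell(r)$ satisfies $\chi_\rho(H^\ell(r))\ge 6$.
   Context: All graphs are simple; $d_G(u,v)$ is the shortest-path distance. A packing $k$-colouring of $G$ is a map $\pi:V(G)\to\{1,\dots,k\}$ such that for distinct $u,v$, $\pi(u)=\pi(v)=i$ implies $d_G(u,v)>i$; $\chi_\rho(G)$ is the least $k$ for which a packing $k$-colouring exists. For integers $r\ge 2$ and $\ell\ge 1$, the generalised H-graph $H^\ell(r)$ has vertex set $\{u^i_j: 0\le i\le \ell+1,\ 0\le j\le 2r-1\}$ and edge set consisting of: $u^0_ju^0_{j+1}$ and $u^{\ell+1}_ju^{\ell+1}_{j+1}$ for $0\le j\le 2r-1$ (subscripts modulo $2r$); $u^i_{2j}u^i_{2j+1}$ for $1\le i\le \ell$, $0\le j\le r-1$; and $u^i_ju^{i+1}_j$ for $0\le i\le \ell$, $0\le j\le 2r-1$. -}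

module Defs where

open import Data.Nat using (ℕ; zero; suc; _+_; _*_; _≤_; _<_)
open import Data.Nat.Properties using ()
open import Data.Fin using (Fin; toℕ)
open import Data.Product using (_×_; _,_; ∃; ∃-syntax; proj₁; proj₂)
open import Data.Sum using (_⊎_)
open import Data.Empty using (⊥)
open import Relation.Nullary using (¬_)
open import Relation.Binary.PropositionalEquality using (_≡_)

data Walk {V : Set} (E : V → V → Set) : V → V → ℕ → Set where
  here : ∀ {u} → Walk E u u 0
  step : ∀ {u w v k} → E u w → Walk E w v k → Walk E u v (suc k)

-- d_G(u,v) ≤ i  iff there is a walk of length at most i from u to v.
-- (d_G(u,v) > i is its negation; this also covers d = ∞.)
DistLe : {V : Set} → (V → V → Set) → V → V → ℕ → Set
DistLe E u v i = ∃[ k ] (k ≤ i × Walk E u v k)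

-- Packing k-colouring with colours 1..k; colour of x is  suc (toℕ (π x)).
IsPackingColouring : {V : Set} → (V → V → Set) → (k : ℕ) → (V → Fin k) → Set
IsPackingColouring E k π =
  ∀ u v → ¬ (u ≡ v) → π u ≡ π v → ¬ DistLe E u v (suc (toℕ (π u)))

-- χ_ρ(G) ≥ m  iff G has no packing k-colouring for any k < m.
ChiRhoGe : {V : Set} → (V → V → Set) → ℕ → Set
ChiRhoGe {V} E m = ∀ k → k < m → (π : V → Fin k) → ¬ IsPackingColouring E k π

-- Generalised H-graph H^ℓ(r): vertex u^i_j is the pair (i , j),
-- i ∈ {0..ℓ+1}, j ∈ {0..2r-1}.
HVertex : ℕ → ℕ → Set
HVertex ℓ r = Fin (suc (suc ℓ)) × Fin (r + r)

CycSucc : ℕ → ℕ → ℕ → Set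
CycSucc r j j' = (j' ≡ suc j) ⊎ ((suc j ≡ r + r) × (j' ≡ 0))

data HEdge (ℓ r : ℕ) : HVertex ℓ r → HVertex ℓ r → Set where
  cyc0 : ∀ {a b j j'} → toℕ a ≡ 0 → toℕ b ≡ 0 →
         CycSucc r (toℕ j) (toℕ j') → HEdge ℓ r (a , j) (b , j')
  cycL : ∀ {a b j j'} → toℕ a ≡ suc ℓ → toℕ b ≡ suc ℓ →
         CycSucc r (toℕ j) (toℕ j') → HEdge ℓ r (a , j) (b , j')
  rung : ∀ {a b j j'} (m : ℕ) → toℕ a ≡ toℕ b → 1 ≤ toℕ a → toℕ a ≤ ℓ →
         toℕ j ≡ m + m → toℕ j' ≡ suc (m + m) → HEdge ℓ r (a , j) (b , j')
  spoke : ∀ {a b j j'} → toℕ b ≡ suc (toℕ a) → toℕ j ≡ toℕ j' →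
          HEdge ℓ r (a , j) (b , j')

HAdj : (ℓ r : ℕ) → HVertex ℓ r → HVertex ℓ r → Set
HAdj ℓ r x y = HEdge ℓ r x y ⊎ HEdge ℓ r y x

-- Cut them into
-- windows of five consecutive columns starting at the even columns 0, 2, 4, …; a packing
-- colouring with at most five colours restricts to a packing colouring of the fixed 3 × 5
-- ladder of each window, because walks inside the ladder are walks in H. Give the colouring of
-- three consecutive columns (a state) a phase bit. An exhaustive search over the 4178 packing
-- 5-colourings of the ladder shows that the two states of a window, at columns 2j and 2j + 2,
-- always have opposite phases. Going once around the 2r columns returns to the first state
-- after r such steps, so r is even.
module Submission where

open import Defs
open import Data.Nat using (ℕ; _≤_; _+_; _*_)
open import Data.Product using (∃-syntax)
open import Relation.Binary.PropositionalEquality using (_≡_)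

open import Data.Bool using (Bool; true; false; not; _∧_; _xor_; if_then_else_; T)
open import Data.Bool.ListAction using (all; any)
open import Data.Bool.Properties using (T-∧; T-≡; not-involutive; not-¬)
open import Data.Empty using (⊥)
open import Data.Fin using (Fin; zero; suc; toℕ; fromℕ<; inject≤)
open import Data.Fin.Properties using (toℕ-fromℕ<; toℕ-injective; fromℕ<-cong; toℕ-inject≤)
open import Data.List using (List; []; _∷_; length; allFin; foldl; map; applyDownFrom)
open import Data.List.Membership.Propositional.Properties using (∈-allFin)
open import Data.List.Properties using (length-applyDownFrom; map-cong)
import Data.List.Relation.Unary.All as All
open import Data.List.Relation.Unary.All.Properties using (all⁺)
open import Data.Nat using (zero; suc; _∸_; _<_; _≟_; _≤?_; _<?_; _≡ᵇ_; _≤ᵇ_; _%_; _/_; ∣_-_∣;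
                            NonZero; >-nonZero; z≤n; s≤s; s≤s⁻¹)
open import Data.Nat.DivMod
open import Data.Nat.Divisibility using (_∣_; ∣m+n∣m⇒∣n; n∣m*n; ∣⇒≤)
open import Data.Nat.Properties
open import Data.Nat.Tactic.RingSolver using (solve-∀)
open import Data.Product using (_×_; _,_; proj₁; proj₂)
open import Data.Sum using (_⊎_; inj₁; inj₂)
open import Function.Base using (_∘_)
open import Function.Bundles using (Equivalence)
open import Function.Strict using (force′)
open import Relation.Binary using (tri<; tri≈; tri>)
open import Relation.Binary.PropositionalEquality using (refl; sym; trans; cong; cong₂; subst; _≢_; module ≡-Reasoning)
open import Relation.Nullary using (¬_; yes; no; contradiction)
open import Relation.Nullary.Decidable using (_×-dec_)

_++ʷ_ : ∀ {V : Set} {E : V → V → Set} {u v w j k} → Walk E u v j → Walk E v w k → Walk E u w (j + k)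
here     ++ʷ w = w
step e v ++ʷ w = step e (v ++ʷ w)

walk⇒distLe : ∀ {V : Set} {E : V → V → Set} {u v k} → Walk E u v k → DistLe E u v k
walk⇒distLe {k = k} w = k , ≤-refl , w

¬T⇒T-not : ∀ {b} → ¬ T b → T (not b)
¬T⇒T-not {true}  ¬t = ¬t _
¬T⇒T-not {false} _  = _

T-if-then : ∀ {b c} → T (if b then c else true) → T b → T c
T-if-then {true} t _ = t

xor≡true⇒≡not : ∀ {a b} → a xor b ≡ true → a ≡ not b
xor≡true⇒≡not {true}  {false} _ = refl
xor≡true⇒≡not {false} {true}  _ = refl

alternating-odd : (f : ℕ → Bool) → (∀ j → f (suc j) ≡ not (f j)) → ∀ t → f (1 + 2 * t) ≡ not (f 0)
alternating-odd f flips zero    = flips 0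
alternating-odd f flips (suc t) = begin
  f (1 + 2 * suc t)          ≡⟨ cong (f ∘ suc) (*-suc 2 t) ⟩
  f (3 + 2 * t)              ≡⟨ flips (2 + 2 * t) ⟩
  not (f (2 + 2 * t))        ≡⟨ cong not (flips (1 + 2 * t)) ⟩
  not (not (f (1 + 2 * t)))  ≡⟨ not-involutive _ ⟩
  f (1 + 2 * t)              ≡⟨ alternating-odd f flips t ⟩
  not (f 0)                  ∎
  where open ≡-Reasoning

double : ℕ → ℕ
double zero    = zero
double (suc j) = suc (suc (double j))

double≡m+m : ∀ j → double j ≡ j + j
double≡m+m zero    = refl
double≡m+m (suc j) = cong suc (trans (cong suc (double≡m+m j)) (sym (+-suc j j)))

m≤n⇒n+o≡[n∸m]+[m+o] : ∀ {m n} o → m ≤ n → n + o ≡ (n ∸ m) + (m + o)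
m≤n⇒n+o≡[n∸m]+[m+o] {m} {n} o m≤n = trans (cong (_+ o) (sym (m∸n+n≡m m≤n))) (+-assoc (n ∸ m) m o)

module _ (n : ℕ) .{{_ : NonZero n}} where

  [1+m]%n≡[1+m%n]%n : ∀ x → suc x % n ≡ suc (x % n) % n
  [1+m]%n≡[1+m%n]%n x =
    trans (cong (λ y → suc y % n) (m≡m%n+[m/n]*n x n)) ([m+kn]%n≡m%n (suc (x % n)) (x / n) n)

  [1+m]%n≡1+m%n⊎0 : ∀ x → (suc x % n ≡ suc (x % n)) ⊎ (suc (x % n) ≡ n × suc x % n ≡ 0)
  [1+m]%n≡1+m%n⊎0 x with suc (x % n) <? n
  ... | yes lt = inj₁ (trans ([1+m]%n≡[1+m%n]%n x) (m<n⇒m%n≡m lt))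
  ... | no ¬lt = inj₂ (wraps , trans ([1+m]%n≡[1+m%n]%n x) (trans (cong (_% n) wraps) (n%n≡0 n)))
    where
    wraps : suc (x % n) ≡ n
    wraps = ≤-antisym (m%n<n x n) (≮⇒≥ ¬lt)

  [d+m]%n≢m%n : ∀ {d} y → 0 < d → d < n → (d + y) % n ≢ y % n
  [d+m]%n≢m%n {d} y 0<d d<n eq = <⇒≱ d<n (∣⇒≤ {{>-nonZero 0<d}} n∣d)
    where
    open ≡-Reasoning
    q q′ : ℕ
    q  = y / n
    q′ = (d + y) / n
    rearrange : ∀ a b c → a + b + c ≡ b + (c + a)
    rearrange = solve-∀
    multiples : q * n + d ≡ q′ * n
    multiples = +-cancelʳ-≡ (y % n) _ _ (begin
      q * n + d + y % n      ≡⟨ rearrange (q * n) d (y % n) ⟩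
      d + (y % n + q * n)    ≡⟨ cong (d +_) (m≡m%n+[m/n]*n y n) ⟨
      d + y                  ≡⟨ m≡m%n+[m/n]*n (d + y) n ⟩
      (d + y) % n + q′ * n   ≡⟨ cong (_+ q′ * n) eq ⟩
      y % n + q′ * n         ≡⟨ +-comm (y % n) (q′ * n) ⟩
      q′ * n + y % n         ∎)
    n∣d : n ∣ d
    n∣d = ∣m+n∣m⇒∣n (subst (n ∣_) (sym multiples) (n∣m*n q′)) (n∣m*n q)

  [m+o]%n≡[n+o]%n⇒m≡n : ∀ {a b} y → a < n → b < n → (a + y) % n ≡ (b + y) % n → a ≡ b
  [m+o]%n≡[n+o]%n⇒m≡n {a} {b} y a<n b<n eq with <-cmp a b
  ... | tri≈ _ a≡b _ = a≡b
  ... | tri< a<b _ _ =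
    contradiction (trans (cong (_% n) (sym (m≤n⇒n+o≡[n∸m]+[m+o] y (<⇒≤ a<b)))) (sym eq))
                  ([d+m]%n≢m%n (a + y) (n≢0⇒n>0 (m>n⇒m∸n≢0 a<b)) (≤-<-trans (m∸n≤m b a) b<n))
  ... | tri> _ _ b<a =
    contradiction (trans (cong (_% n) (sym (m≤n⇒n+o≡[n∸m]+[m+o] y (<⇒≤ b<a)))) eq)
                  ([d+m]%n≢m%n (b + y) (n≢0⇒n>0 (m>n⇒m∸n≢0 b<a)) (≤-<-trans (m∸n≤m a b) a<n))

module _ (r : ℕ) .{{_ : NonZero r}} .{{_ : NonZero (r + r)}} where

  [e+m+m]%[r+r]≡e+[m%r+m%r] : ∀ e m → e + (m % r + m % r) < r + r →
                               (e + (m + m)) % (r + r) ≡ e + (m % r + m % r)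
  [e+m+m]%[r+r]≡e+[m%r+m%r] e m bound = begin
    (e + (m + m)) % (r + r)                      ≡⟨ cong (λ x → (e + (x + x)) % (r + r)) (m≡m%n+[m/n]*n m r) ⟩
    (e + ((u + q * r) + (u + q * r))) % (r + r)  ≡⟨ cong (_% (r + r)) (regroup e u q r) ⟩
    (e + (u + u) + q * (r + r)) % (r + r)        ≡⟨ [m+kn]%n≡m%n (e + (u + u)) q (r + r) ⟩
    (e + (u + u)) % (r + r)                      ≡⟨ m<n⇒m%n≡m bound ⟩
    e + (u + u)                                  ∎
    where
    open ≡-Reasoning
    u q : ℕ
    u = m % r
    q = m / r
    regroup : ∀ e u q r → e + ((u + q * r) + (u + q * r)) ≡ e + (u + u) + q * (r + r)
    regroup = solve-∀

Colour : Set
Colour = Fin 5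

row column : ℕ → ℕ
row    p = p % 3
column p = p / 3

-- Length of a walk between two window cells inside the ladder: up or down a column, across a
-- rung (rungs join the columns 2m and 2m + 1 of rows 1 and 2), or up to the rim, along it, and
-- down again.
cellDistance : ℕ → ℕ → ℕ
cellDistance p q with column p ≟ column q
... | yes _ = ∣ row p - row q ∣
... | no _ with column p % 2 ≟ 0 ×-dec column q ≟ suc (column p) ×-dec 1 ≤? row p ×-dec 1 ≤? row q
...   | yes _ = suc ∣ row p - row q ∣
...   | no _  = row p + ((column q ∸ column p) + row q)

clash : ℕ → Colour → ℕ → Colour → Bool
clash p x q y = (toℕ x ≡ᵇ toℕ y) ∧ (cellDistance p q ≤ᵇ suc (toℕ x))

-- A partial colouring of the window is a list of colours of the cells length − 1, …, 1, 0.
compatible : ℕ → Colour → List Colour → Bool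
compatible q y []       = true
compatible q y (x ∷ xs) = not (clash (length xs) x q y) ∧ compatible q y xs

colourAt : List Colour → ℕ → Colour
colourAt []       p = zero
colourAt (x ∷ xs) p = if p ≡ᵇ length xs then x else colourAt xs p

phaseCells : List ℕ
phaseCells = 0 ∷ 1 ∷ 3 ∷ 4 ∷ 5 ∷ 6 ∷ []

stateColours : (ℕ → Colour) → ℕ → List Colour
stateColours κ o = map (λ p → κ (o + p)) phaseCells

phaseCode : List Colour → ℕ
phaseCode = foldl (λ code x → 10 * code + suc (toℕ x)) 0

-- The states of phase true, each written as the colours 1–5 of its phase cells. Found by
-- computer: the graph joining the two states of every packing colouring of the ladder is
-- bipartite, and this is one side of a bipartition.
phaseTable : List ℕ
phaseTable =
  123141 ∷ 123142 ∷ 123145 ∷ 124131 ∷ 124132 ∷ 124135 ∷ 124151 ∷ 124152 ∷ 124312 ∷ 132141 ∷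
  132145 ∷ 132411 ∷ 132415 ∷ 134121 ∷ 134122 ∷ 134125 ∷ 134151 ∷ 134152 ∷ 134211 ∷ 134251 ∷
  142131 ∷ 142135 ∷ 142151 ∷ 142315 ∷ 143121 ∷ 143122 ∷ 143125 ∷ 143151 ∷ 143152 ∷ 143251 ∷
  154121 ∷ 154131 ∷ 154211 ∷ 154231 ∷ 211315 ∷ 211325 ∷ 211413 ∷ 211415 ∷ 211423 ∷ 211425 ∷
  231425 ∷ 234121 ∷ 234125 ∷ 234151 ∷ 241325 ∷ 243121 ∷ 243125 ∷ 254121 ∷ 254131 ∷ 311215 ∷
  311412 ∷ 311415 ∷ 311422 ∷ 311452 ∷ 312415 ∷ 321412 ∷ 411213 ∷ 411215 ∷ 411253 ∷ 411312 ∷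
  411315 ∷ 411322 ∷ 411352 ∷ 411512 ∷ 411513 ∷ 411522 ∷ 411523 ∷ 411532 ∷ 412311 ∷ 412315 ∷
  412511 ∷ 412513 ∷ 412531 ∷ 421312 ∷ 421352 ∷ 421512 ∷ 421513 ∷ 421532 ∷ []

-- Opaque, so that typechecking never unfolds the lookup on a symbolic colouring; the code is
-- forced once since Agda's evaluator would otherwise recompute it for every table entry.
opaque
  phase : List Colour → Bool
  phase cs = force′ (phaseCode cs) (λ code → any (_≡ᵇ code) phaseTable)

alternatesᵇ : (ℕ → Colour) → Bool
alternatesᵇ κ = phase (stateColours κ 0) xor phase (stateColours κ 6)

sweep : ℕ → List Colour → Bool
extend : ℕ → List Colour → Colour → Bool

sweep zero    acc = alternatesᵇ (colourAt acc)
sweep (suc m) acc = all (extend m acc) (allFin 5)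

extend m acc y = if compatible (length acc) y acc then sweep m (y ∷ acc) else true

opaque
  unfolding phase

  sweep-succeeds : sweep 15 [] ≡ true
  sweep-succeeds = refl

sweep-step : ∀ {m acc} y → sweep (suc m) acc ≡ true → T (compatible (length acc) y acc) → sweep m (y ∷ acc) ≡ true
sweep-step {m} {acc} y swept fits =
  Equivalence.to T-≡ (T-if-then (All.lookup (all⁺ (extend m acc) (allFin 5) (Equivalence.from T-≡ swept)) (∈-allFin y)) fits)

module _ (κ : ℕ → Colour) where

  compatible-if-no-clash : ∀ q y j → (∀ p → p < j → ¬ T (clash p (κ p) q y)) →
                           T (compatible q y (applyDownFrom κ j))
  compatible-if-no-clash q y zero    _ = _
  compatible-if-no-clash q y (suc j) no-clash rewrite length-applyDownFrom κ j =
    Equivalence.from T-∧ (¬T⇒T-not (no-clash j ≤-refl) ,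
                          compatible-if-no-clash q y j (λ p p<j → no-clash p (m<n⇒m<1+n p<j)))

  -- The lists are passed through equations so that checking this lemma never evaluates sweep.
  sweep-sound : ∀ m k {acc} → acc ≡ applyDownFrom κ k → sweep m acc ≡ true →
                (∀ q → q < m + k → T (compatible q (κ q) (applyDownFrom κ q))) →
                ∀ {full} → full ≡ applyDownFrom κ (m + k) → sweep 0 full ≡ true
  sweep-sound zero    k refl swept _ refl = swept
  sweep-sound (suc m) k refl swept fits refl =
    sweep-sound m (suc k) refl (sweep-step {m} {applyDownFrom κ k} (κ k) swept fits-k)
      (λ q q< → fits q (subst (q <_) (+-suc m k) q<)) (cong (applyDownFrom κ) (sym (+-suc m k)))
    where
    fits-k : T (compatible (length (applyDownFrom κ k)) (κ k) (applyDownFrom κ k))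
    fits-k = subst (λ j → T (compatible j (κ k) (applyDownFrom κ k))) (sym (length-applyDownFrom κ k))
               (fits k (s≤s (m≤n+m k m)))

  phase-flips-across-window : (∀ {p q} → p < q → q < 15 → ¬ T (clash p (κ p) q (κ q))) →
                              phase (stateColours κ 0) ≡ not (phase (stateColours κ 6))
  phase-flips-across-window no-clash = xor≡true⇒≡not (begin
    alternatesᵇ κ                    ≡⟨ cong₂ (λ a b → phase a xor phase b) read-back₀ read-back₆ ⟩
    alternatesᵇ (colourAt snapshot)  ≡⟨ sweep-sound 15 0 {[]} refl sweep-succeeds fits {snapshot} refl ⟩
    true                             ∎)
    where
    open ≡-Reasoning
    snapshot : List Colour
    snapshot = applyDownFrom κ 15
    read-back₀ : stateColours κ 0 ≡ stateColours (colourAt snapshot) 0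
    read-back₀ = refl
    read-back₆ : stateColours κ 6 ≡ stateColours (colourAt snapshot) 6
    read-back₆ = refl
    fits : ∀ q → q < 15 → T (compatible q (κ q) (applyDownFrom κ q))
    fits q q<15 = compatible-if-no-clash q (κ q) q (λ p p<q → no-clash p<q q<15)

module GeneralisedHGraph (L r₂ : ℕ) where

  ℓ r n : ℕ
  ℓ = 2 + L
  r = 3 + r₂
  n = r + r

  Vertex : Set
  Vertex = HVertex ℓ r

  G : Vertex → Vertex → Set
  G = HAdj ℓ r

  col : ℕ → Fin n
  col x = fromℕ< (m%n<n x n)

  toℕ-col : ∀ x → toℕ (col x) ≡ x % n
  toℕ-col x = toℕ-fromℕ< (m%n<n x n)

  col-cong : ∀ {x y} → x % n ≡ y % n → col x ≡ col y
  col-cong {x} {y} e = fromℕ<-cong (x % n) (y % n) e (m%n<n x n) (m%n<n y n)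

  -- Only rows 0, 1, 2 are used; larger arguments are junk.
  level : ℕ → Fin (2 + ℓ)
  level 0 = zero
  level 1 = suc zero
  level _ = suc (suc zero)

  toℕ-level : ∀ {i} → i < 3 → toℕ (level i) ≡ i
  toℕ-level {0} _ = refl
  toℕ-level {1} _ = refl
  toℕ-level {2} _ = refl
  toℕ-level {suc (suc (suc _))} (s≤s (s≤s (s≤s ())))

  rim-edge : ∀ x → G (zero , col x) (zero , col (suc x))
  rim-edge x = inj₁ (cyc0 refl refl next)
    where
    next : CycSucc r (toℕ (col x)) (toℕ (col (suc x)))
    next rewrite toℕ-col x | toℕ-col (suc x) = [1+m]%n≡1+m%n⊎0 n x

  down-edge : ∀ {a b} y → toℕ b ≡ suc (toℕ a) → G (a , y) (b , y)
  down-edge y e = inj₁ (spoke e refl)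

  up-edge : ∀ {a b} y → toℕ a ≡ suc (toℕ b) → G (a , y) (b , y)
  up-edge y e = inj₂ (spoke e refl)

  toℕ-col-even : ∀ m → toℕ (col (m + m)) ≡ m % r + m % r
  toℕ-col-even m =
    trans (toℕ-col (m + m)) ([e+m+m]%[r+r]≡e+[m%r+m%r] r 0 m (+-mono-< (m%n<n m r) (m%n<n m r)))

  toℕ-col-odd : ∀ m → toℕ (col (suc (m + m))) ≡ suc (m % r + m % r)
  toℕ-col-odd m =
    trans (toℕ-col (suc (m + m))) ([e+m+m]%[r+r]≡e+[m%r+m%r] r 1 m (+-mono-≤-< (m%n<n m r) (m%n<n m r)))

  rung-edge : ∀ {i} m → 1 ≤ i → i < 3 → G (level i , col (m + m)) (level i , col (suc (m + m)))
  rung-edge {1} m _ _ = inj₁ (rung (m % r) refl (s≤s z≤n) (s≤s z≤n) (toℕ-col-even m) (toℕ-col-odd m))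
  rung-edge {2} m _ _ = inj₁ (rung (m % r) refl (s≤s z≤n) (s≤s (s≤s z≤n)) (toℕ-col-even m) (toℕ-col-odd m))
  rung-edge {suc (suc (suc _))} m _ (s≤s (s≤s (s≤s ())))

  vertical : ∀ {i j} y → i < 3 → j < 3 → Walk G (level i , y) (level j , y) ∣ i - j ∣
  vertical {0} {0} y _ _ = here
  vertical {0} {1} y _ _ = step (down-edge y refl) here
  vertical {0} {2} y _ _ = step (down-edge y refl) (step (down-edge y refl) here)
  vertical {1} {0} y _ _ = step (up-edge y refl) here
  vertical {1} {1} y _ _ = here
  vertical {1} {2} y _ _ = step (down-edge y refl) here
  vertical {2} {0} y _ _ = step (up-edge y refl) (step (up-edge y refl) here)
  vertical {2} {1} y _ _ = step (up-edge y refl) here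
  vertical {2} {2} y _ _ = here
  vertical {suc (suc (suc _))} y (s≤s (s≤s (s≤s ()))) _
  vertical {_} {suc (suc (suc _))} y _ (s≤s (s≤s (s≤s ())))

  along-rim : ∀ d x → Walk G (zero , col x) (zero , col (d + x)) d
  along-rim zero    x = here
  along-rim (suc d) x =
    step (rim-edge x) (subst (λ y → Walk G (zero , col (suc x)) (zero , col y) d) (+-suc d x) (along-rim d (suc x)))

  rim-route : ∀ {i j} x d → i < 3 → j < 3 → Walk G (level i , col x) (level j , col (d + x)) (i + (d + j))
  rim-route {i} x d i<3 j<3 =
    subst (Walk G _ _) (cong (_+ _) (∣-∣-identityʳ i))
      (vertical (col x) i<3 (s≤s z≤n) ++ʷ (along-rim d x ++ʷ vertical (col (d + x)) (s≤s z≤n) j<3))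

  rung-route : ∀ {i j} m → 1 ≤ i → i < 3 → j < 3 →
               Walk G (level i , col (m + m)) (level j , col (suc (m + m))) (suc ∣ i - j ∣)
  rung-route m 1≤i i<3 j<3 = step (rung-edge m 1≤i i<3) (vertical (col (suc (m + m))) i<3 j<3)

  cell : ℕ → ℕ → Vertex
  cell t p = level (row p) , col (column p + t)

  row<3 : ∀ p → row p < 3
  row<3 p = m%n<n p 3

  route : ∀ m {p q} → p < q → DistLe G (cell (m + m) p) (cell (m + m) q) (cellDistance p q)
  route m {p} {q} p<q with column p ≟ column q
  ... | yes same =
    walk⇒distLe (subst (λ c → Walk G (cell (m + m) p) (level (row q) , col (c + (m + m))) ∣ row p - row q ∣)
                  same (vertical (col (column p + (m + m))) (row<3 p) (row<3 q)))
  ... | no _ with column p % 2 ≟ 0 ×-dec column q ≟ suc (column p) ×-dec 1 ≤? row p ×-dec 1 ≤? row q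
  ...   | yes (even , next , 1≤i , _) =
    walk⇒distLe (subst (λ c → Walk G (cell (m + m) p) (level (row q) , col (c + (m + m))) (suc ∣ row p - row q ∣))
                  (sym next)
                  (subst (λ x → Walk G (level (row p) , col x) (level (row q) , col (suc x)) (suc ∣ row p - row q ∣))
                    (sym aligned) (rung-route (h + m) 1≤i (row<3 p) (row<3 q))))
    where
    h : ℕ
    h = column p / 2
    halves : ∀ h m → h * 2 + (m + m) ≡ (h + m) + (h + m)
    halves = solve-∀
    aligned : column p + (m + m) ≡ (h + m) + (h + m)
    aligned = trans (cong (_+ (m + m)) (trans (m≡m%n+[m/n]*n (column p) 2) (cong (_+ h * 2) even))) (halves h m)
  ...   | no _ =
    walk⇒distLe (subst (λ c → Walk G (cell (m + m) p) (level (row q) , col c) (row p + ((column q ∸ column p) + row q)))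
                  (sym (m≤n⇒n+o≡[n∸m]+[m+o] (m + m) (/-monoˡ-≤ 3 (<⇒≤ p<q))))
                  (rim-route (column p + (m + m)) (column q ∸ column p) (row<3 p) (row<3 q)))

  column<n : ∀ {p} → p < 15 → column p < n
  column<n {p} p<15 = ≤-<-trans (/-monoˡ-≤ 3 (s≤s⁻¹ p<15)) 4<n
    where
    4<n : 4 < n
    4<n = s≤s (s≤s (s≤s (≤-trans (s≤s (s≤s z≤n)) (m≤n+m (3 + r₂) r₂))))

  cell-injective : ∀ t {p q} → p < 15 → q < 15 → cell t p ≡ cell t q → p ≡ q
  cell-injective t {p} {q} p<15 q<15 e = begin
    p                     ≡⟨ m≡m%n+[m/n]*n p 3 ⟩
    row p + column p * 3  ≡⟨ cong₂ (λ i c → i + c * 3) same-row same-column ⟩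
    row q + column q * 3  ≡⟨ m≡m%n+[m/n]*n q 3 ⟨
    q                     ∎
    where
    open ≡-Reasoning
    same-row : row p ≡ row q
    same-row = trans (sym (toℕ-level (row<3 p))) (trans (cong (toℕ ∘ proj₁) e) (toℕ-level (row<3 q)))
    same-column : column p ≡ column q
    same-column = [m+o]%n≡[n+o]%n⇒m≡n n t (column<n p<15) (column<n q<15)
      (trans (sym (toℕ-col (column p + t))) (trans (cong (toℕ ∘ proj₂) e) (toℕ-col (column q + t))))

  module _ {k} (k≤5 : k ≤ 5) (π : Vertex → Fin k) (packing : IsPackingColouring G k π) where

    window : ℕ → ℕ → Colour
    window t p = inject≤ (π (cell t p)) k≤5

    window-no-clash : ∀ {t} m → t ≡ m + m → ∀ {p q} → p < q → q < 15 → ¬ T (clash p (window t p) q (window t q))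
    window-no-clash {t} m refl {p} {q} p<q q<15 clashes = packing (cell t p) (cell t q) distinct same-colour near
      where
      matches : T (toℕ (window t p) ≡ᵇ toℕ (window t q)) × T (cellDistance p q ≤ᵇ suc (toℕ (window t p)))
      matches = Equivalence.to T-∧ clashes
      same-colour : π (cell t p) ≡ π (cell t q)
      same-colour =
        toℕ-injective (trans (sym (toℕ-inject≤ _ k≤5)) (trans (≡ᵇ⇒≡ _ _ (proj₁ matches)) (toℕ-inject≤ _ k≤5)))
      close : cellDistance p q ≤ suc (toℕ (π (cell t p)))
      close = subst (λ c → cellDistance p q ≤ suc c) (toℕ-inject≤ _ k≤5) (≤ᵇ⇒≤ _ _ (proj₂ matches))
      distinct : cell t p ≢ cell t q
      distinct e = <⇒≢ p<q (cell-injective t (<-trans p<q q<15) q<15 e)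
      near : DistLe G (cell t p) (cell t q) (suc (toℕ (π (cell t p))))
      near with route m p<q
      ... | len , len≤ , w = len , ≤-trans len≤ close , w

    phaseAt : ℕ → Bool
    phaseAt j = phase (stateColours (window (double j)) 0)

    phaseAt-flips : ∀ j → phaseAt (suc j) ≡ not (phaseAt j)
    phaseAt-flips j = begin
      phaseAt (suc j)                                         ≡⟨⟩
      phase (stateColours (window (double j)) 6)              ≡⟨ not-involutive _ ⟨
      not (not (phase (stateColours (window (double j)) 6)))  ≡⟨ cong not (phase-flips-across-window
                                                                   (window (double j)) (window-no-clash j (double≡m+m j))) ⟨
      not (phaseAt j)                                         ∎
      where open ≡-Reasoning

    window-periodic : ∀ p → window (double r) p ≡ window 0 p
    window-periodic p =
      cong (λ c → inject≤ (π (level (row p) , c)) k≤5) (col-cong {column p + double r} {column p + 0} wraps)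
      where
      wraps : (column p + double r) % n ≡ (column p + 0) % n
      wraps = trans (cong (λ x → (column p + x) % n) (double≡m+m r))
                (trans ([m+n]%n≡m%n (column p) n) (cong (_% n) (sym (+-identityʳ (column p)))))

    phaseAt-periodic : phaseAt r ≡ phaseAt 0
    phaseAt-periodic = cong phase (map-cong (λ p → window-periodic (0 + p)) phaseCells)

    no-packing-5-colouring : ∀ t → r ≡ 1 + 2 * t → ⊥
    no-packing-5-colouring t odd = not-¬ refl (begin
      phaseAt 0          ≡⟨ phaseAt-periodic ⟨
      phaseAt r          ≡⟨ cong phaseAt odd ⟩
      phaseAt (1 + 2 * t) ≡⟨ alternating-odd phaseAt phaseAt-flips t ⟩
      not (phaseAt 0)    ∎)
      where open ≡-Reasoning

corollary16 : (ℓ r : ℕ) → 3 ≤ ℓ → 3 ≤ r → ∃[ t ] (r ≡ 1 + 2 * t) →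
    ChiRhoGe (HAdj ℓ r) 6
corollary16 (suc (suc (suc L))) (suc (suc (suc r₂))) (s≤s (s≤s (s≤s _))) (s≤s (s≤s (s≤s _))) (t , odd)
            k (s≤s k≤5) π packing =
  GeneralisedHGraph.no-packing-5-colouring (suc L) r₂ k≤5 π packing t odd
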